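{- Let $T$ be a finite rooted tree with root $v_0$ and at least one vertex other than the root, and let $n$ be the maximum level of a vertex of $T$. Let $u_n,u_{n-1},\ldots,u_1$ be any sequence produced by the Unburning Algorithm on $T$ (with ties broken arbitrarily). Then the number of vertices of $T$ saved by vaccinating $u_i$ at time step $i$ for $i=1,\ldots,n$, namely $\bigl|\bigcup_{i=1}^{n} V(T_{u_i})\bigr| = \sum_{i=1}^n \tilde{\mathrm{wt}}(u_i)$, is at least half of the maximum number of vertices of $T$ that can be saved by any vaccination strategy (one vaccination per time step) in the virus-spread model on $T$.
   Context: Virus-spread model on a rooted tree $T$ with root $v_0$: each vertex is susceptible, infected, or vaccinated, and these latter two states are permanent. At time step $0$ the root $v_0$ is infected and all other vertices are susceptible. At each time step $t=1,2,\ldots$, one susceptible vertex may be vaccinated, and then every susceptible vertex adjacent to an infected vertex becomes infected. The process continues until no infected vertex has a susceptible neighbor. A vertex is saved if it is never infected; an optimal strategy is one maximizing the number of saved vertices. Notation: the level of a vertex $v$ is $l(v)=d(v_0,v)$, the number of edges on the path from $v_0$ to $v$; $T_v$ denotes the subtree of $T$ rooted at $v$ (i.e. $v$ and all its descendants). Unburning Algorithm: working backwards from level $n$ (the maximum level) down to level $1$, for $i=n,n-1,\ldots,1$ choose a vertex $u_i$ with $l(u_i)=i$ as follows. For a vertex $v$ with $l(v)=i$, let $U_v=\bigcup V(T_{u})$, the union over those already chosen vertices $u\in\{u_n,\ldots,u_{i+1}\}$ that lie in $T_v$ (empty if there are none), and set $\tilde{\mathrm{wt}}(v)=|V(T_v)|-|U_v|$.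 Then $u_i$ is chosen among the vertices $v$ at level $i$ to maximize $\tilde{\mathrm{wt}}(v)$. -}

module Defs where

open import Data.Nat using (ℕ; zero; suc; _+_; _∸_; _≤_; _<_; _*_)
open import Data.Fin using (Fin; zero; suc; toℕ; _≟_)
open import Data.Bool using (Bool; true; false; if_then_else_; _∧_; _∨_; not)
open import Data.Maybe using (Maybe; just; nothing)
open import Data.List using (List; []; _∷_; length; map; upTo; allFin; drop)
open import Data.Bool.ListAction using (any)
open import Data.Nat.ListAction using (sum)
open import Data.Unit using (⊤)
open import Data.Product using (_×_)
open import Relation.Nullary.Decidable using (⌊_⌋)
open import Relation.Binary.PropositionalEquality using (_≡_)

-- A rooted tree with (suc m) vertices is given on the vertex set Fin (suc m),
-- with root `zero`; vertex `suc i` has parent `par i`, whose index is at most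
-- toℕ i (i.e. strictly smaller than the index of `suc i`).  Every finite rooted
-- tree admits such a labelling (e.g. BFS order), and every such data is a tree.

record RTree : Set where
  field
    m    : ℕ
    par  : Fin m → Fin (suc m)
    par≤ : ∀ i → toℕ (par i) ≤ toℕ i

module _ (T : RTree) where
  open RTree T

  Vtx : Set
  Vtx = Fin (suc m)

  root : Vtx
  root = zero

  _==_ : Vtx → Vtx → Bool
  u == v = ⌊ u ≟ v ⌋

  -- ancestors of v (v itself first, ending at the root); the fuel argument
  -- toℕ v suffices because parents have strictly smaller index.
  ancF : ℕ → Vtx → List Vtx
  ancF _       zero    = zero ∷ []
  ancF zero    (suc i) = suc i ∷ []          -- unreachable with enough fuel
  ancF (suc f) (suc i) = suc i ∷ ancF f (par i)

  ancestors : Vtx → List Vtx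
  ancestors v = ancF (toℕ v) v

  level : Vtx → ℕ
  level v = length (ancestors v) ∸ 1

  -- u ≼ w : u is w or an ancestor of w, i.e. w ∈ V(T_u)
  inSub : Vtx → Vtx → Bool
  inSub u w = any (_== u) (ancestors w)

  count : (Vtx → Bool) → ℕ
  count p = sum (map (λ w → if p w then 1 else 0) (allFin (suc m)))

  subSize : Vtx → ℕ
  subSize v = count (inSub v)

  data St : Set where
    sus inf vac : St

  isInf : St → Bool
  isInf inf = true
  isInf _   = false

  State : Set
  State = Vtx → St

  initial : State
  initial zero    = inf
  initial (suc _) = sus

  infNbr : State → Vtx → Bool
  infNbr s zero    = any (λ j → (par j == zero) ∧ isInf (s (suc j))) (allFin m)
  infNbr s (suc i) = isInf (s (par i))
                   ∨ any (λ j → (par j == suc i) ∧ isInf (s (suc j))) (allFin m)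

  spread : State → State
  spread s w with s w
  ... | sus = if infNbr s w then inf else sus
  ... | st  = st

  vaccinate : State → Maybe Vtx → State
  vaccinate s nothing  = s
  vaccinate s (just v) w = if w == v then vac else s w

  step : State → Maybe Vtx → State
  step s c = spread (vaccinate s c)

  runSteps : State → List (Maybe Vtx) → State
  runSteps s []       = s
  runSteps s (c ∷ cs) = runSteps (step s c) cs

  Legal : State → List (Maybe Vtx) → Set
  Legal s []              = ⊤
  Legal s (nothing ∷ cs)  = Legal (step s nothing) cs
  Legal s (just v ∷ cs)   = (s v ≡ sus) × Legal (step s (just v)) cs

  spreadN : ℕ → State → State
  spreadN zero    s = s
  spreadN (suc k) s = spreadN k (spread s)

  -- final state: after the strategy's time steps, the process continues
  -- (without vaccinations) until it stabilises; suc m further steps suffice,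
  -- and extra steps on a stable state change nothing.
  final : List (Maybe Vtx) → State
  final cs = spreadN (suc m) (runSteps initial cs)

  -- number of saved (never infected) vertices; infection is permanent
  saved : List (Maybe Vtx) → ℕ
  saved cs = count (λ w → not (isInf (final cs w)))

  -- The Unburning Algorithm, with maximum level n and the chosen
  -- sequence given as a function u : ℕ → Vtx (only u 1, …, u n matter).

  above : ℕ → ℕ → List ℕ
  above n i = map suc (drop i (upTo n))

  -- w ∈ U_v, where U_v is the union of V(T_{u_j}) over i < j ≤ n with u_j ∈ T_v
  inU : ℕ → (ℕ → Vtx) → ℕ → Vtx → Vtx → Bool
  inU n u i v w = any (λ j → inSub v (u j) ∧ inSub (u j) w) (above n i)

  wt~ : ℕ → (ℕ → Vtx) → ℕ → Vtx → ℕ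
  wt~ n u i v = subSize v ∸ count (inU n u i v)

  Unburning : ℕ → (ℕ → Vtx) → Set
  Unburning n u = ∀ i → 1 ≤ i → i ≤ n →
    (level (u i) ≡ i) × (∀ v → level v ≡ i → wt~ n u i v ≤ wt~ n u i (u i))

  unburnStrategy : ℕ → (ℕ → Vtx) → List (Maybe Vtx)
  unburnStrategy n u = map (λ i → just (u (suc i))) (upTo n)

  wtSum : ℕ → (ℕ → Vtx) → ℕ
  wtSum n u = sum (map (λ i → wt~ n u (suc i) (u (suc i))) (upTo n))

-- On a tree the spreading process has a closed form: after t time steps, with the vertices Vs
-- vaccinated so far, a vertex is infected iff its level is at most t and none of its ancestors
-- (itself included) lies in Vs. So a legal strategy saves exactly the union of the subtrees T_v of
-- its vaccinated vertices, and the Unburning strategy, which is legal because l(u_i) = i, saves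
-- U = ⋃ V(T_{u_i}); its size telescopes to Σ w̃t(u_i), since w̃t(u_i) counts the vertices of T_{u_i}
-- in no T_{u_j} with j > i.
-- For the factor 2, charge what another legal strategy saves outside U to the time steps: a vertex v
-- vaccinated at step t+1 that is not already protected has level > t, so T_v lies in T_a for the
-- ancestor a of v at level t+1, and the part of T_a outside ⋃_{j>t+1} T_{u_j} has at most
-- w̃t(a) ≤ w̃t(u_{t+1}) vertices. Summing over the steps, at most Σ w̃t(u_i) = |U| vertices are saved
-- outside U.

module Submission where

open import Defs
open import Data.Nat using (ℕ; zero; suc; _+_; _∸_; _≤_; _<_; _*_; _≤ᵇ_; z≤n; s≤s)
open import Data.Nat.Properties hiding (_≟_)
open import Data.Fin using (zero; suc; toℕ; _≟_)
open import Data.Fin.Properties using (toℕ<n)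
open import Data.Bool using (Bool; true; false; if_then_else_; _∧_; _∨_; not; T; T?)
open import Data.Bool.Properties using (T-∧; T-∨; T-not-≡; ∧-distribʳ-∨; ∧-inverseʳ; ∨-identityʳ; not-involutive)
open import Data.Maybe using (Maybe; just; nothing)
open import Data.List using (List; []; _∷_; length; map; upTo; allFin; drop; applyUpTo; catMaybes; _ʳ++_)
open import Data.List.Properties using (map-upTo; drop-[])
open import Data.Bool.ListAction using (any)
open import Data.Nat.ListAction using (sum)
open import Data.List.Relation.Unary.All as All using (All; []; _∷_; lookup)
open import Data.List.Relation.Unary.Any.Properties using (any⁺; any⁻; reverseAcc⁺; reverseAcc⁻)
open import Data.List.Membership.Propositional using (_∈_; find; lose)
open import Data.List.Membership.Propositional.Properties using (∈-applyUpTo⁻; ∈-map⁻)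
open import Data.Product using (_×_; ∃; _,_; proj₁; proj₂)
open import Data.Sum using (_⊎_; inj₁; inj₂; [_,_]′)
open import Data.Empty using (⊥; ⊥-elim)
open import Data.Unit using (tt)
open import Function using (_∘_; id)
open import Function.Bundles using (Equivalence)
open import Relation.Nullary using (¬_; yes; no)
open import Relation.Nullary.Decidable using (⌊_⌋; toWitness; fromWitness)
open import Relation.Binary.PropositionalEquality

open Equivalence using (to; from)

T-ext : ∀ {a b} → (T a → T b) → (T b → T a) → a ≡ b
T-ext {false} {false} _ _ = refl
T-ext {false} {true}  _ g = ⊥-elim (g tt)
T-ext {true}  {false} f _ = ⊥-elim (f tt)
T-ext {true}  {true}  _ _ = refl

T⇒≡true : ∀ {a} → T a → a ≡ true
T⇒≡true {true} _ = refl

¬T⇒≡false : ∀ {a} → ¬ T a → a ≡ false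
¬T⇒≡false {false} _ = refl
¬T⇒≡false {true}  f = ⊥-elim (f tt)

≤ᵇ-suc : ∀ m n → (suc m ≤ᵇ suc n) ≡ (m ≤ᵇ n)
≤ᵇ-suc m n = T-ext (λ t → ≤⇒≤ᵇ (≤-pred (≤ᵇ⇒≤ (suc m) (suc n) t)))
                   (λ t → ≤⇒≤ᵇ (s≤s (≤ᵇ⇒≤ m n t)))

module _ {A : Set} where

  any-cong : ∀ {p q : A → Bool} → p ≗ q → ∀ xs → any p xs ≡ any q xs
  any-cong e []       = refl
  any-cong e (x ∷ xs) = cong₂ _∨_ (e x) (any-cong e xs)

  T-any⁻ : ∀ (p : A → Bool) xs → T (any p xs) → ∃ λ x → x ∈ xs × T (p x)
  T-any⁻ p xs = find ∘ any⁻ p xs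

  T-any⁺ : ∀ (p : A → Bool) {x xs} → x ∈ xs → T (p x) → T (any p xs)
  T-any⁺ p x∈xs px = any⁺ p (lose x∈xs px)

  any-ʳ++[] : ∀ (p : A → Bool) xs → any p (xs ʳ++ []) ≡ any p xs
  any-ʳ++[] p xs = T-ext (λ t → [ (λ ()) , any⁺ p ]′ (reverseAcc⁻ [] xs (any⁻ p _ t)))
                         (λ t → any⁺ p (reverseAcc⁺ [] xs (inj₂ (any⁻ p xs t))))

  any-map : ∀ {B : Set} (p : B → Bool) (f : A → B) xs → any p (map f xs) ≡ any (p ∘ f) xs
  any-map p f []       = refl
  any-map p f (x ∷ xs) = cong (p (f x) ∨_) (any-map p f xs)

  -- count τ p is countIn (allFin (suc m)) p by definition.
  countIn : List A → (A → Bool) → ℕ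
  countIn xs p = sum (map (λ x → if p x then 1 else 0) xs)

  countIn-cong : ∀ xs {p q : A → Bool} → p ≗ q → countIn xs p ≡ countIn xs q
  countIn-cong []       e = refl
  countIn-cong (x ∷ xs) e = cong₂ (λ b k → (if b then 1 else 0) + k) (e x) (countIn-cong xs e)

  countIn-false : ∀ xs {p : A → Bool} → (∀ x → p x ≡ false) → countIn xs p ≡ 0
  countIn-false []       e = refl
  countIn-false (x ∷ xs) e rewrite e x = countIn-false xs e

  countIn-mono : ∀ xs {p q : A → Bool} → (∀ x → T (p x) → T (q x)) → countIn xs p ≤ countIn xs q
  countIn-mono []       h = z≤n
  countIn-mono (x ∷ xs) {p} {q} h with p x in px | q x in qx
  ... | true  | true  = s≤s (countIn-mono xs h)
  ... | true  | false = ⊥-elim (subst T qx (h x (subst T (sym px) tt)))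
  ... | false | true  = m≤n⇒m≤1+n (countIn-mono xs h)
  ... | false | false = countIn-mono xs h

  countIn-split : ∀ xs (p q : A → Bool) →
    countIn xs p ≡ countIn xs (λ x → p x ∧ q x) + countIn xs (λ x → p x ∧ not (q x))
  countIn-split []       p q = refl
  countIn-split (x ∷ xs) p q with p x | q x
  ... | true  | true  = cong suc (countIn-split xs p q)
  ... | true  | false = trans (cong suc (countIn-split xs p q)) (sym (+-suc _ _))
  ... | false | _     = countIn-split xs p q

  countIn-∨ : ∀ xs (p q : A → Bool) → countIn xs (λ x → p x ∨ q x) ≤ countIn xs p + countIn xs q
  countIn-∨ []       p q = z≤n
  countIn-∨ (x ∷ xs) p q with p x | q x
  ... | true  | true  = s≤s (≤-trans (countIn-∨ xs p q) (+-monoʳ-≤ (countIn xs p) (n≤1+n _)))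
  ... | true  | false = s≤s (countIn-∨ xs p q)
  ... | false | true  = subst (suc (countIn xs (λ x → p x ∨ q x)) ≤_) (sym (+-suc (countIn xs p) _))
                                (s≤s (countIn-∨ xs p q))
  ... | false | false = countIn-∨ xs p q

  catMaybes-map-just : ∀ {B : Set} (f : A → B) xs → catMaybes (map (just ∘ f) xs) ≡ map f xs
  catMaybes-map-just f []       = refl
  catMaybes-map-just f (x ∷ xs) = cong (f x ∷_) (catMaybes-map-just f xs)

  drop-applyUpTo-∷ : ∀ (f : ℕ → A) {k n} → k < n →
                     drop k (applyUpTo f n) ≡ f k ∷ drop (suc k) (applyUpTo f n)
  drop-applyUpTo-∷ f {zero}  {suc n} _         = refl
  drop-applyUpTo-∷ f {suc k} {suc n} (s≤s k<n) = drop-applyUpTo-∷ (f ∘ suc) k<n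

  drop-applyUpTo-[] : ∀ (f : ℕ → A) {k n} → n ≤ k → drop k (applyUpTo f n) ≡ []
  drop-applyUpTo-[] f {k}     {zero}  _         = drop-[] k
  drop-applyUpTo-[] f {suc k} {suc n} (s≤s n≤k) = drop-applyUpTo-[] (f ∘ suc) n≤k

  ∈-drop-applyUpTo⁻ : ∀ (f : ℕ → A) k {n x} → x ∈ drop k (applyUpTo f n) →
                      ∃ λ i → k ≤ i × i < n × x ≡ f i
  ∈-drop-applyUpTo⁻ f zero    x∈ with i , i<n , x≡fi ← ∈-applyUpTo⁻ f x∈ = i , z≤n , i<n , x≡fi
  ∈-drop-applyUpTo⁻ f (suc k) {suc n} x∈
    with i , k≤i , i<n , x≡fi ← ∈-drop-applyUpTo⁻ (f ∘ suc) k x∈ = suc i , s≤s k≤i , s≤s i<n , x≡fi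

module Tree (τ : RTree) where
  open RTree τ

  V : Set
  V = Vtx τ

  lev : V → ℕ
  lev = level τ

  vertices : List V
  vertices = allFin (suc m)

  parent-ind : (P : V → Set) → P zero → (∀ i → P (par i) → P (suc i)) → ∀ v → P v
  parent-ind P P-root P-suc v = go (toℕ v) v ≤-refl
    where
    go : ∀ f v → toℕ v ≤ f → P v
    go _       zero    _         = P-root
    go (suc f) (suc i) (s≤s i≤f) = P-suc i (go f (par i) (≤-trans (par≤ i) i≤f))

  ancF-fuel : ∀ f g v → toℕ v ≤ f → toℕ v ≤ g → ancF τ f v ≡ ancF τ g v
  ancF-fuel _       _       zero    _         _         = refl
  ancF-fuel (suc f) (suc g) (suc i) (s≤s i≤f) (s≤s i≤g) =
    cong (suc i ∷_) (ancF-fuel f g (par i) (≤-trans (par≤ i) i≤f) (≤-trans (par≤ i) i≤g))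

  ancestors-suc : ∀ i → ancestors τ (suc i) ≡ suc i ∷ ancestors τ (par i)
  ancestors-suc i = cong (suc i ∷_) (ancF-fuel (toℕ i) (toℕ (par i)) (par i) (par≤ i) ≤-refl)

  ancF-nonempty : ∀ f v → length (ancF τ f v) ≡ suc (length (ancF τ f v) ∸ 1)
  ancF-nonempty _       zero    = refl
  ancF-nonempty zero    (suc i) = refl
  ancF-nonempty (suc f) (suc i) = refl

  length-ancF≤ : ∀ f v → length (ancF τ f v) ≤ suc f
  length-ancF≤ _       zero    = s≤s z≤n
  length-ancF≤ zero    (suc i) = s≤s z≤n
  length-ancF≤ (suc f) (suc i) = s≤s (length-ancF≤ f (par i))

  level-suc : ∀ i → lev (suc i) ≡ suc (lev (par i))
  level-suc i = begin
    length (ancestors τ (suc i)) ∸ 1 ≡⟨ cong (λ xs → length xs ∸ 1) (ancestors-suc i) ⟩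
    length (ancestors τ (par i))     ≡⟨ ancF-nonempty (toℕ (par i)) (par i) ⟩
    suc (lev (par i))                ∎
    where open ≡-Reasoning

  level≤m : ∀ v → lev v ≤ m
  level≤m v = ≤-trans (∸-monoˡ-≤ 1 (length-ancF≤ (toℕ v) v)) (≤-pred (toℕ<n v))

  -- A record rather than T (inSub τ a w), so that a and w can be inferred.
  record _≼_ (a w : V) : Set where
    constructor ≼ᵇ⇒≼
    field ≼⇒≼ᵇ : T (inSub τ a w)

  open _≼_ public

  inSub-suc : ∀ a i → inSub τ a (suc i) ≡ ⌊ suc i ≟ a ⌋ ∨ inSub τ a (par i)
  inSub-suc a i = cong (any (λ b → ⌊ b ≟ a ⌋)) (ancestors-suc i)

  ≼-refl : ∀ a → a ≼ a
  ≼-refl zero    = ≼ᵇ⇒≼ tt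
  ≼-refl (suc i) = ≼ᵇ⇒≼ (subst T (sym (inSub-suc (suc i) i))
                                 (from T-∨ (inj₁ (fromWitness {a? = suc i ≟ suc i} refl))))

  ≼-root⁻ : ∀ {a} → a ≼ zero → a ≡ zero
  ≼-root⁻ {a} (≼ᵇ⇒≼ a≼0) with to T-∨ a≼0
  ... | inj₁ 0≡a = sym (toWitness {a? = zero ≟ a} 0≡a)

  ≼-suc⁻ : ∀ {a} i → a ≼ suc i → a ≡ suc i ⊎ a ≼ par i
  ≼-suc⁻ {a} i (≼ᵇ⇒≼ a≼) with to T-∨ (subst T (inSub-suc a i) a≼)
  ... | inj₁ i≡a = inj₁ (sym (toWitness {a? = suc i ≟ a} i≡a))
  ... | inj₂ a≼p = inj₂ (≼ᵇ⇒≼ a≼p)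

  ≼-par : ∀ {a} i → a ≼ par i → a ≼ suc i
  ≼-par {a} i (≼ᵇ⇒≼ a≼p) = ≼ᵇ⇒≼ (subst T (sym (inSub-suc a i)) (from T-∨ (inj₂ a≼p)))

  ≼-trans : ∀ {a b c} → a ≼ b → b ≼ c → a ≼ c
  ≼-trans {a} {b} {c} a≼b b≼c = parent-ind (λ c → ∀ {b} → a ≼ b → b ≼ c → a ≼ c) at-root at-suc c a≼b b≼c
    where
    at-root : ∀ {b} → a ≼ b → b ≼ zero → a ≼ zero
    at-root a≼b b≼0 with refl ← ≼-root⁻ b≼0 = a≼b
    at-suc : ∀ i → (∀ {b} → a ≼ b → b ≼ par i → a ≼ par i) → ∀ {b} → a ≼ b → b ≼ suc i → a ≼ suc i
    at-suc i ih a≼b b≼ with ≼-suc⁻ i b≼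
    ... | inj₁ refl = a≼b
    ... | inj₂ b≼p  = ≼-par i (ih a≼b b≼p)

  level-mono : ∀ {a w} → a ≼ w → lev a ≤ lev w
  level-mono {a} {w} = parent-ind (λ w → a ≼ w → lev a ≤ lev w) at-root at-suc w
    where
    at-root : a ≼ zero → lev a ≤ lev zero
    at-root a≼0 with refl ← ≼-root⁻ a≼0 = ≤-refl
    at-suc : ∀ i → (a ≼ par i → lev a ≤ lev (par i)) → a ≼ suc i → lev a ≤ lev (suc i)
    at-suc i ih a≼ with ≼-suc⁻ i a≼
    ... | inj₁ refl = ≤-refl
    ... | inj₂ a≼p  = ≤-trans (ih a≼p) (≤-trans (n≤1+n _) (≤-reflexive (sym (level-suc i))))

  ≼-linear : ∀ {a b w} → a ≼ w → b ≼ w → lev a ≤ lev b → a ≼ b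
  ≼-linear {a} {b} {w} = parent-ind (λ w → a ≼ w → b ≼ w → lev a ≤ lev b → a ≼ b) at-root at-suc w
    where
    at-root : a ≼ zero → b ≼ zero → lev a ≤ lev b → a ≼ b
    at-root a≼0 b≼0 _ with refl ← ≼-root⁻ a≼0 | refl ← ≼-root⁻ b≼0 = ≼-refl zero
    at-suc : ∀ i → (a ≼ par i → b ≼ par i → lev a ≤ lev b → a ≼ b) →
           a ≼ suc i → b ≼ suc i → lev a ≤ lev b → a ≼ b
    at-suc i ih a≼ b≼ a≤b with ≼-suc⁻ i a≼ | ≼-suc⁻ i b≼
    ... | _         | inj₁ refl = a≼
    ... | inj₂ a≼p  | inj₂ b≼p  = ih a≼p b≼p a≤b
    ... | inj₁ refl | inj₂ b≼p  =
      ⊥-elim (<⇒≱ (subst (lev b <_) (sym (level-suc i)) (s≤s (level-mono b≼p))) a≤b)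

  ancestor-at-level : ∀ {k} v → k ≤ lev v → ∃ λ a → a ≼ v × lev a ≡ k
  ancestor-at-level {k} = parent-ind (λ v → k ≤ lev v → ∃ λ a → a ≼ v × lev a ≡ k) at-root at-suc
    where
    at-root : k ≤ lev zero → ∃ λ a → a ≼ zero × lev a ≡ k
    at-root z≤n = zero , ≼-refl zero , refl
    at-suc : ∀ i → (k ≤ lev (par i) → ∃ λ a → a ≼ par i × lev a ≡ k) →
           k ≤ lev (suc i) → ∃ λ a → a ≼ suc i × lev a ≡ k
    at-suc i ih k≤ with m≤n⇒m<n∨m≡n (subst (k ≤_) (level-suc i) k≤)
    ... | inj₂ refl      = suc i , ≼-refl (suc i) , level-suc i
    ... | inj₁ (s≤s k≤p) with a , a≼p , lev-a ← ih k≤p = a , ≼-par i a≼p , lev-a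

module Process (τ : RTree) where
  open RTree τ
  open Tree τ

  -- Unlike ⌊ w ∈? Vs ⌋, this unfolds on v ∷ Vs to the test ⌊ w ≟ v ⌋ made by vaccinate.
  _∈ᵇ_ : V → List V → Bool
  w ∈ᵇ Vs = any (λ a → ⌊ w ≟ a ⌋) Vs

  ∈ᵇ⇒∈ : ∀ {w} Vs → T (w ∈ᵇ Vs) → w ∈ Vs
  ∈ᵇ⇒∈ {w} Vs w∈ with a , a∈ , w≡a ← T-any⁻ _ Vs w∈
    rewrite toWitness {a? = w ≟ a} w≡a = a∈

  ∈⇒∈ᵇ : ∀ {w Vs} → w ∈ Vs → T (w ∈ᵇ Vs)
  ∈⇒∈ᵇ {w} w∈ = T-any⁺ _ w∈ (fromWitness {a? = w ≟ w} refl)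

  inSubs : List V → V → Bool
  inSubs Vs w = any (λ a → inSub τ a w) Vs

  inSubs⁻ : ∀ Vs {w} → T (inSubs Vs w) → ∃ λ a → a ∈ Vs × a ≼ w
  inSubs⁻ Vs t with a , a∈ , a≼w ← T-any⁻ _ Vs t = a , a∈ , ≼ᵇ⇒≼ a≼w

  inSubs⁺ : ∀ {Vs a w} → a ∈ Vs → a ≼ w → T (inSubs Vs w)
  inSubs⁺ a∈ a≼w = T-any⁺ _ a∈ (≼⇒≼ᵇ a≼w)

  inSubs-≼ : ∀ Vs {a w} → a ≼ w → T (inSubs Vs a) → T (inSubs Vs w)
  inSubs-≼ Vs a≼w t with b , b∈ , b≼a ← inSubs⁻ Vs t = inSubs⁺ b∈ (≼-trans b≼a a≼w)

  burning : ℕ → List V → V → Bool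
  burning t Vs w = (lev w ≤ᵇ t) ∧ not (inSubs Vs w)

  status : Bool → Bool → St τ
  status true  _     = vac
  status false true  = inf
  status false false = sus

  stateAt : ℕ → List V → State τ
  stateAt t Vs w = status (w ∈ᵇ Vs) (burning t Vs w)

  burning⁻ : ∀ t Vs w → T (burning t Vs w) → lev w ≤ t × ¬ T (inSubs Vs w)
  burning⁻ t Vs w b with lev≤ , fresh ← to T-∧ b =
    ≤ᵇ⇒≤ (lev w) t lev≤ , λ covered → subst T (to T-not-≡ fresh) covered

  burning⁺ : ∀ t Vs w → lev w ≤ t → ¬ T (inSubs Vs w) → T (burning t Vs w)
  burning⁺ t Vs w lev≤ fresh = from T-∧ (≤⇒≤ᵇ lev≤ , from T-not-≡ (¬T⇒≡false fresh))

  burning-≼ : ∀ t Vs {a w} → a ≼ w → T (burning t Vs w) → T (burning t Vs a)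
  burning-≼ t Vs {a} {w} a≼w b with lev≤ , fresh ← burning⁻ t Vs w b =
    burning⁺ t Vs a (≤-trans (level-mono a≼w) lev≤) (fresh ∘ inSubs-≼ Vs a≼w)

  burning-suc : ∀ t Vs w → T (burning t Vs w) → T (burning (suc t) Vs w)
  burning-suc t Vs w b with lev≤ , fresh ← burning⁻ t Vs w b =
    burning⁺ (suc t) Vs w (m≤n⇒m≤1+n lev≤) fresh

  burning-inSubs : ∀ t Vs w → T (inSubs Vs w) → burning t Vs w ≡ false
  burning-inSubs t Vs w covered = ¬T⇒≡false λ b → proj₂ (burning⁻ t Vs w b) covered

  not-burning⁻ : ∀ t Vs w → burning t Vs w ≡ false → t < lev w ⊎ T (inSubs Vs w)
  not-burning⁻ t Vs w nb with t <? lev w | T? (inSubs Vs w)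
  ... | yes t<lev | _         = inj₁ t<lev
  ... | no _      | yes c     = inj₂ c
  ... | no t≮lev  | no fresh  = ⊥-elim (subst T nb (burning⁺ t Vs w (≮⇒≥ t≮lev) fresh))

  inSubs-suc : ∀ Vs i → suc i ∈ᵇ Vs ≡ false → inSubs Vs (suc i) ≡ inSubs Vs (par i)
  inSubs-suc Vs i i∉ = T-ext from-suc (inSubs-≼ Vs (≼-par i (≼-refl (par i))))
    where
    from-suc : T (inSubs Vs (suc i)) → T (inSubs Vs (par i))
    from-suc c with a , a∈ , a≼ ← inSubs⁻ Vs c with ≼-suc⁻ i a≼
    ... | inj₁ refl = ⊥-elim (subst T i∉ (∈⇒∈ᵇ a∈))
    ... | inj₂ a≼p  = inSubs⁺ a∈ a≼p

  burning-par : ∀ t Vs i → suc i ∈ᵇ Vs ≡ false → burning (suc t) Vs (suc i) ≡ burning t Vs (par i)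
  burning-par t Vs i i∉ =
    cong₂ (λ l c → l ∧ not c) (trans (cong (_≤ᵇ suc t) (level-suc i)) (≤ᵇ-suc (lev (par i)) t))
                              (inSubs-suc Vs i i∉)

  status-sus⁻ : ∀ b c → status b c ≡ sus → b ≡ false × c ≡ false
  status-sus⁻ false false _ = refl , refl

  isInf-status : ∀ b c → (T b → c ≡ false) → isInf τ (status b c) ≡ c
  isInf-status true  c     vac⇒ = sym (vac⇒ tt)
  isInf-status false true  _    = refl
  isInf-status false false _    = refl

  isInf-stateAt : ∀ t Vs w → isInf τ (stateAt t Vs w) ≡ burning t Vs w
  isInf-stateAt t Vs w = isInf-status (w ∈ᵇ Vs) (burning t Vs w)
    (λ w∈ → burning-inSubs t Vs w (inSubs⁺ (∈ᵇ⇒∈ Vs w∈) (≼-refl w)))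

  spreadAt : St τ → Bool → St τ
  spreadAt sus b = if b then inf else sus
  spreadAt st  _ = st

  spread-spreadAt : ∀ s w → spread τ s w ≡ spreadAt (s w) (infNbr τ s w)
  spread-spreadAt s w with s w
  ... | sus = refl
  ... | inf = refl
  ... | vac = refl

  spreadAt-status : ∀ b c c′ nb → (T c → T c′) → (b ≡ false → c ≡ false → nb ≡ c′) →
                    spreadAt (status b c) nb ≡ status b c′
  spreadAt-status true  _     _     _  _    _     = refl
  spreadAt-status false true  true  _  _    _     = refl
  spreadAt-status false true  false _  c⇒c′ _     = ⊥-elim (c⇒c′ tt)
  spreadAt-status false false true  nb _    nb≡c′ rewrite nb≡c′ refl refl = refl
  spreadAt-status false false false nb _    nb≡c′ rewrite nb≡c′ refl refl = refl

  infNbr-cong : ∀ {s s′} → s ≗ s′ → infNbr τ s ≗ infNbr τ s′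
  infNbr-cong e zero    = any-cong (λ j → cong (λ st → ⌊ par j ≟ zero ⌋ ∧ isInf τ st) (e (suc j))) (allFin m)
  infNbr-cong e (suc i) = cong₂ _∨_ (cong (isInf τ) (e (par i)))
    (any-cong (λ j → cong (λ st → ⌊ par j ≟ suc i ⌋ ∧ isInf τ st) (e (suc j))) (allFin m))

  spread-cong : ∀ {s s′} → s ≗ s′ → spread τ s ≗ spread τ s′
  spread-cong {s} {s′} e w = begin
    spread τ s w                    ≡⟨ spread-spreadAt s w ⟩
    spreadAt (s w) (infNbr τ s w)   ≡⟨ cong₂ spreadAt (e w) (infNbr-cong e w) ⟩
    spreadAt (s′ w) (infNbr τ s′ w) ≡⟨ spread-spreadAt s′ w ⟨
    spread τ s′ w                   ∎
    where open ≡-Reasoning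

  vaccinate-cong : ∀ {s s′} → s ≗ s′ → ∀ c → vaccinate τ s c ≗ vaccinate τ s′ c
  vaccinate-cong e nothing  w = e w
  vaccinate-cong e (just v) w = cong (if ⌊ w ≟ v ⌋ then vac else_) (e w)

  no-burning-child : ∀ t Vs w → burning t Vs w ≡ false →
    any (λ j → ⌊ par j ≟ w ⌋ ∧ isInf τ (stateAt t Vs (suc j))) (allFin m) ≡ false
  no-burning-child t Vs w w-safe = ¬T⇒≡false λ c → child-burning (T-any⁻ _ (allFin m) c)
    where
    child-burning : (∃ λ j → j ∈ allFin m × T (⌊ par j ≟ w ⌋ ∧ isInf τ (stateAt t Vs (suc j)))) → ⊥
    child-burning (j , _ , c) with par≡w , infected ← to T-∧ c
      with refl ← toWitness {a? = par j ≟ w} par≡w =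
      subst T w-safe (burning-≼ t Vs (≼-par j (≼-refl (par j)))
                                (subst T (isInf-stateAt t Vs (suc j)) infected))

  infNbr-stateAt : ∀ t Vs w → w ∈ᵇ Vs ≡ false → burning t Vs w ≡ false →
                   infNbr τ (stateAt t Vs) w ≡ burning (suc t) Vs w
  infNbr-stateAt t Vs zero    _   w-safe = trans (no-burning-child t Vs zero w-safe) (sym w-safe)
  infNbr-stateAt t Vs (suc i) i∉ w-safe = begin
    isInf τ (stateAt t Vs (par i)) ∨ _   ≡⟨ cong₂ _∨_ (isInf-stateAt t Vs (par i))
                                                       (no-burning-child t Vs (suc i) w-safe) ⟩
    burning t Vs (par i) ∨ false         ≡⟨ ∨-identityʳ _ ⟩
    burning t Vs (par i)                 ≡⟨ burning-par t Vs i i∉ ⟨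
    burning (suc t) Vs (suc i)           ∎
    where open ≡-Reasoning

  spread-stateAt : ∀ t Vs → spread τ (stateAt t Vs) ≗ stateAt (suc t) Vs
  spread-stateAt t Vs w =
    trans (spread-spreadAt (stateAt t Vs) w)
          (spreadAt-status (w ∈ᵇ Vs) (burning t Vs w) (burning (suc t) Vs w) _
                           (burning-suc t Vs w) (infNbr-stateAt t Vs w))

  burning-∷ : ∀ t Vs v → stateAt t Vs v ≡ sus → ∀ w → burning t (v ∷ Vs) w ≡ burning t Vs w
  burning-∷ t Vs v v-sus w = T-ext forget-v keep-v
    where
    forget-v : T (burning t (v ∷ Vs) w) → T (burning t Vs w)
    forget-v b with lev≤ , fresh ← burning⁻ t (v ∷ Vs) w b =
      burning⁺ t Vs w lev≤ (fresh ∘ from T-∨ ∘ inj₂)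
    keep-v : T (burning t Vs w) → T (burning t (v ∷ Vs) w)
    keep-v b with lev≤ , fresh ← burning⁻ t Vs w b =
      burning⁺ t (v ∷ Vs) w lev≤ ([ v-burning , fresh ]′ ∘ to T-∨)
      where
      v-burning : T (inSub τ v w) → ⊥
      v-burning v≼w = subst T (proj₂ (status-sus⁻ _ _ v-sus)) (burning-≼ t Vs {v} {w} (≼ᵇ⇒≼ v≼w) b)

  if-vac-status : ∀ b c d → (if b then vac else status c d) ≡ status (b ∨ c) d
  if-vac-status true  _ _ = refl
  if-vac-status false _ _ = refl

  vaccinate-stateAt : ∀ t Vs v → stateAt t Vs v ≡ sus →
                      vaccinate τ (stateAt t Vs) (just v) ≗ stateAt t (v ∷ Vs)
  vaccinate-stateAt t Vs v v-sus w =
    trans (if-vac-status ⌊ w ≟ v ⌋ (w ∈ᵇ Vs) (burning t Vs w))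
          (cong (status (w ∈ᵇ (v ∷ Vs))) (sym (burning-∷ t Vs v v-sus w)))

  step-nothing-stateAt : ∀ t Vs {s} → s ≗ stateAt t Vs → step τ s nothing ≗ stateAt (suc t) Vs
  step-nothing-stateAt t Vs s≗ w = trans (spread-cong s≗ w) (spread-stateAt t Vs w)

  step-just-stateAt : ∀ t Vs {s v} → s ≗ stateAt t Vs → s v ≡ sus →
                      step τ s (just v) ≗ stateAt (suc t) (v ∷ Vs)
  step-just-stateAt t Vs {v = v} s≗ v-sus w =
    trans (spread-cong (λ x → trans (vaccinate-cong s≗ (just v) x)
                                    (vaccinate-stateAt t Vs v (trans (sym (s≗ v)) v-sus) x)) w)
          (spread-stateAt t (v ∷ Vs) w)

  runSteps-stateAt : ∀ cs t Vs {s} → s ≗ stateAt t Vs → Legal τ s cs →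
                     runSteps τ s cs ≗ stateAt (length cs + t) (catMaybes cs ʳ++ Vs)
  runSteps-stateAt []             t Vs s≗ _ = s≗
  runSteps-stateAt (nothing ∷ cs) t Vs s≗ legal w =
    trans (runSteps-stateAt cs (suc t) Vs (step-nothing-stateAt t Vs s≗) legal w)
          (cong (λ t′ → stateAt t′ (catMaybes cs ʳ++ Vs) w) (+-suc (length cs) t))
  runSteps-stateAt (just v ∷ cs)  t Vs s≗ (v-sus , legal) w =
    trans (runSteps-stateAt cs (suc t) (v ∷ Vs) (step-just-stateAt t Vs s≗ v-sus) legal w)
          (cong (λ t′ → stateAt t′ (catMaybes cs ʳ++ v ∷ Vs) w) (+-suc (length cs) t))

  spreadN-stateAt : ∀ k t Vs {s} → s ≗ stateAt t Vs → spreadN τ k s ≗ stateAt (k + t) Vs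
  spreadN-stateAt zero    t Vs s≗ = s≗
  spreadN-stateAt (suc k) t Vs s≗ w =
    trans (spreadN-stateAt k (suc t) Vs (step-nothing-stateAt t Vs s≗) w)
          (cong (λ t′ → stateAt t′ Vs w) (+-suc k t))

  initial-stateAt : initial τ ≗ stateAt 0 []
  initial-stateAt zero    = refl
  initial-stateAt (suc i) = cong (λ l → status false ((l ≤ᵇ 0) ∧ true)) (sym (level-suc i))

  saved-stateAt : ∀ t Vs w → lev w ≤ t → not (isInf τ (stateAt t Vs w)) ≡ inSubs Vs w
  saved-stateAt t Vs w lev≤ = begin
    not (isInf τ (stateAt t Vs w))
      ≡⟨ cong not (isInf-stateAt t Vs w) ⟩
    not ((lev w ≤ᵇ t) ∧ not (inSubs Vs w))
      ≡⟨ cong (λ b → not (b ∧ not (inSubs Vs w))) (T⇒≡true (≤⇒≤ᵇ lev≤)) ⟩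
    not (not (inSubs Vs w))
      ≡⟨ not-involutive _ ⟩
    inSubs Vs w
      ∎
    where open ≡-Reasoning

  saved-legal : ∀ cs → Legal τ (initial τ) cs → saved τ cs ≡ count τ (inSubs (catMaybes cs ʳ++ []))
  saved-legal cs legal = countIn-cong vertices λ w →
    trans (cong (not ∘ isInf τ) (spreadN-stateAt (suc m) t₀ Vc (runSteps-stateAt cs 0 [] initial-stateAt legal) w))
          (saved-stateAt (suc m + t₀) Vc w (≤-trans (level≤m w) (≤-trans (n≤1+n m) (m≤m+n (suc m) t₀))))
    where
    t₀ : ℕ
    t₀ = length cs + 0
    Vc : List V
    Vc = catMaybes cs ʳ++ []

  stateAt-sus : ∀ t Vs v → All (λ x → lev x ≤ t) Vs → t < lev v → stateAt t Vs v ≡ sus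
  stateAt-sus t Vs v Vs≤t t<v = cong₂ status
    (¬T⇒≡false λ v∈ → <⇒≱ t<v (lookup Vs≤t (∈ᵇ⇒∈ Vs v∈)))
    (¬T⇒≡false λ b → <⇒≱ t<v (proj₁ (burning⁻ t Vs v b)))

  legal-applyUpTo : ∀ d (f : ℕ → V) t Vs {s} → s ≗ stateAt t Vs → All (λ x → lev x ≤ t) Vs →
                    (∀ i → i < d → lev (f i) ≡ suc (t + i)) → Legal τ s (applyUpTo (just ∘ f) d)
  legal-applyUpTo zero    f t Vs s≗ Vs≤t f-lev = tt
  legal-applyUpTo (suc d) f t Vs {s} s≗ Vs≤t f-lev =
    f0-sus , legal-applyUpTo d (f ∘ suc) (suc t) (f 0 ∷ Vs) (step-just-stateAt t Vs s≗ f0-sus)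
                             (≤-reflexive f0-lev ∷ All.map m≤n⇒m≤1+n Vs≤t)
                             (λ i i<d → trans (f-lev (suc i) (s≤s i<d)) (cong suc (+-suc t i)))
    where
    f0-lev : lev (f 0) ≡ suc t
    f0-lev = trans (f-lev 0 (s≤s z≤n)) (cong suc (+-identityʳ t))
    f0-sus : s (f 0) ≡ sus
    f0-sus = trans (s≗ (f 0)) (stateAt-sus t Vs (f 0) Vs≤t (≤-reflexive (sym f0-lev)))

module Unburning (τ : RTree) (n : ℕ) (u : ℕ → Vtx τ) where
  open RTree τ
  open Tree τ
  open Process τ

  above-∷ : ∀ {k} → k < n → above τ n k ≡ suc k ∷ above τ n (suc k)
  above-∷ k<n = cong (map suc) (drop-applyUpTo-∷ id k<n)

  above-[] : ∀ {k} → n ≤ k → above τ n k ≡ []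
  above-[] n≤k = cong (map suc) (drop-applyUpTo-[] id n≤k)

  ∈-above⁻ : ∀ k {j} → j ∈ above τ n k → k < j × j ≤ n
  ∈-above⁻ k j∈ with x , x∈ , refl ← ∈-map⁻ suc j∈
    with i , k≤i , i<n , refl ← ∈-drop-applyUpTo⁻ id k x∈ = s≤s k≤i , i<n

  covered : ℕ → V → Bool
  covered k w = any (λ j → inSub τ (u j) w) (above τ n k)

  covered-∷ : ∀ {k} → k < n → ∀ w → covered k w ≡ inSub τ (u (suc k)) w ∨ covered (suc k) w
  covered-∷ k<n w = cong (any (λ j → inSub τ (u j) w)) (above-∷ k<n)

  covered-[] : ∀ {k} → n ≤ k → ∀ w → covered k w ≡ false
  covered-[] n≤k w = cong (any (λ j → inSub τ (u j) w)) (above-[] n≤k)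

  covered-suc : ∀ k w → T (covered (suc k) w) → T (covered k w)
  covered-suc k w c with k <? n
  ... | yes k<n = subst T (sym (covered-∷ k<n w)) (from T-∨ (inj₂ c))
  ... | no  k≮n = ⊥-elim (subst T (covered-[] (m≤n⇒m≤1+n (≮⇒≥ k≮n)) w) c)

  covered-zero : ∀ k w → T (covered k w) → T (covered 0 w)
  covered-zero zero    w c = c
  covered-zero (suc k) w c = covered-zero k w (covered-suc k w c)

  count-covered-suc : ∀ k → count τ (covered (suc k)) ≤ count τ (covered k)
  count-covered-suc k = countIn-mono vertices (covered-suc k)

  inU⇒ : ∀ i x w → T (inU τ n u i x w) → T (inSub τ x w ∧ covered i w)
  inU⇒ i x w c with j , j∈ , x≼j≼w ← T-any⁻ _ (above τ n i) c with x≼j , j≼w ← to T-∧ x≼j≼w =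
    from T-∧ (≼⇒≼ᵇ (≼-trans {x} {u j} {w} (≼ᵇ⇒≼ x≼j) (≼ᵇ⇒≼ j≼w)) , T-any⁺ _ j∈ j≼w)

  wt~-≥ : ∀ i x → count τ (λ w → inSub τ x w ∧ not (covered i w)) ≤ wt~ τ n u i x
  wt~-≥ i x = begin
    B                                   ≡⟨ m+n∸m≡n A B ⟨
    (A + B) ∸ A                         ≤⟨ ∸-monoʳ-≤ (A + B) (countIn-mono vertices (inU⇒ i x)) ⟩
    (A + B) ∸ count τ (inU τ n u i x)   ≡⟨ cong (_∸ count τ (inU τ n u i x))
                                                (countIn-split vertices (inSub τ x) (covered i)) ⟨
    wt~ τ n u i x                       ∎
    where
    open ≤-Reasoning
    A B : ℕ
    A = count τ (λ w → inSub τ x w ∧ covered i w)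
    B = count τ (λ w → inSub τ x w ∧ not (covered i w))

  module _ (unb : Unburning τ n u) where

    level-u : ∀ i → 1 ≤ i → i ≤ n → lev (u i) ≡ i
    level-u i 1≤i i≤n = proj₁ (unb i 1≤i i≤n)

    inU⇐ : ∀ i → 1 ≤ i → i ≤ n → ∀ w → T (inSub τ (u i) w ∧ covered i w) → T (inU τ n u i (u i) w)
    inU⇐ i 1≤i i≤n w c with ui≼w , cov ← to T-∧ c
      with j , j∈ , uj≼w ← T-any⁻ _ (above τ n i) cov
      with i<j , j≤n ← ∈-above⁻ i j∈ =
      T-any⁺ _ j∈ (from T-∧ (≼⇒≼ᵇ (≼-linear (≼ᵇ⇒≼ {u i} {w} ui≼w) (≼ᵇ⇒≼ {u j} {w} uj≼w) ui≤uj) , uj≼w))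
      where
      ui≤uj : lev (u i) ≤ lev (u j)
      ui≤uj = subst₂ _≤_ (sym (level-u i 1≤i i≤n)) (sym (level-u j (≤-trans 1≤i (<⇒≤ i<j)) j≤n))
                         (<⇒≤ i<j)

    wt~-u : ∀ i → 1 ≤ i → i ≤ n → wt~ τ n u i (u i) ≡ count τ (λ w → inSub τ (u i) w ∧ not (covered i w))
    wt~-u i 1≤i i≤n = begin
      count τ S ∸ count τ (inU τ n u i (u i))  ≡⟨ cong₂ _∸_ (countIn-split vertices S (covered i))
                                                             (countIn-cong vertices inU≗) ⟩
      (A + B) ∸ A                              ≡⟨ m+n∸m≡n A B ⟩
      B                                        ∎
      where
      open ≡-Reasoning
      S : V → Bool
      S = inSub τ (u i)
      A B : ℕ
      A = count τ (λ w → S w ∧ covered i w)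
      B = count τ (λ w → S w ∧ not (covered i w))
      inU≗ : ∀ w → inU τ n u i (u i) w ≡ (S w ∧ covered i w)
      inU≗ w = T-ext (inU⇒ i (u i) w) (inU⇐ i 1≤i i≤n w)

    count-covered-∷ : ∀ {k} → k < n →
                      count τ (covered k) ≡ wt~ τ n u (suc k) (u (suc k)) + count τ (covered (suc k))
    count-covered-∷ {k} k<n = begin
      count τ (covered k)
        ≡⟨ countIn-split vertices (covered k) C ⟩
      count τ (λ w → covered k w ∧ C w) + count τ (λ w → covered k w ∧ not (C w))
        ≡⟨ cong₂ _+_ (countIn-cong vertices only-C) (countIn-cong vertices only-S) ⟩
      count τ C + count τ (λ w → S w ∧ not (C w))
        ≡⟨ +-comm (count τ C) _ ⟩
      count τ (λ w → S w ∧ not (C w)) + count τ C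
        ≡⟨ cong (_+ count τ C) (wt~-u (suc k) (s≤s z≤n) k<n) ⟨
      wt~ τ n u (suc k) (u (suc k)) + count τ C
        ∎
      where
      open ≡-Reasoning
      S C : V → Bool
      S = inSub τ (u (suc k))
      C = covered (suc k)
      only-C : ∀ w → covered k w ∧ C w ≡ C w
      only-C w = T-ext (proj₂ ∘ to T-∧) (λ c → from T-∧ (covered-suc k w c , c))
      only-S : ∀ w → covered k w ∧ not (C w) ≡ S w ∧ not (C w)
      only-S w = begin
        covered k w ∧ not (C w)                     ≡⟨ cong (_∧ not (C w)) (covered-∷ k<n w) ⟩
        (S w ∨ C w) ∧ not (C w)                     ≡⟨ ∧-distribʳ-∨ (not (C w)) (S w) (C w) ⟩
        (S w ∧ not (C w)) ∨ (C w ∧ not (C w))       ≡⟨ cong ((S w ∧ not (C w)) ∨_) (∧-inverseʳ (C w)) ⟩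
        (S w ∧ not (C w)) ∨ false                   ≡⟨ ∨-identityʳ _ ⟩
        S w ∧ not (C w)                             ∎

    wtSum≡count-covered : wtSum τ n u ≡ count τ (covered 0)
    wtSum≡count-covered = telescope n 0 (+-identityʳ n)
      where
      g : ℕ → ℕ
      g i = wt~ τ n u (suc i) (u (suc i))
      telescope : ∀ d k → d + k ≡ n → sum (map g (drop k (upTo n))) ≡ count τ (covered k)
      telescope zero    k k≡n =
        trans (cong (sum ∘ map g) (drop-applyUpTo-[] id (≤-reflexive (sym k≡n))))
              (sym (countIn-false vertices (covered-[] (≤-reflexive (sym k≡n)))))
      telescope (suc d) k d+k≡n =
        trans (cong (sum ∘ map g) (drop-applyUpTo-∷ id k<n))
              (trans (cong (g k +_) (telescope d (suc k) (trans (+-suc d k) d+k≡n)))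
                     (sym (count-covered-∷ k<n)))
        where
        k<n : k < n
        k<n = subst (k <_) d+k≡n (s≤s (m≤n+m k d))

    unburnStrategy-legal : Legal τ (initial τ) (unburnStrategy τ n u)
    unburnStrategy-legal = subst (Legal τ (initial τ)) (sym (map-upTo (λ i → just (u (suc i))) n))
      (legal-applyUpTo n (u ∘ suc) 0 [] initial-stateAt [] (λ i i<n → level-u (suc i) (s≤s z≤n) i<n))

    saved-unburnStrategy : saved τ (unburnStrategy τ n u) ≡ count τ (covered 0)
    saved-unburnStrategy =
      trans (saved-legal (unburnStrategy τ n u) unburnStrategy-legal) (countIn-cong vertices saved≗)
      where
      saved≗ : ∀ w → inSubs (catMaybes (unburnStrategy τ n u) ʳ++ []) w ≡ covered 0 w
      saved≗ w = begin
        inSubs (catMaybes (unburnStrategy τ n u) ʳ++ []) w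
          ≡⟨ any-ʳ++[] _ (catMaybes (unburnStrategy τ n u)) ⟩
        inSubs (catMaybes (unburnStrategy τ n u)) w
          ≡⟨ cong (λ vs → inSubs vs w) (catMaybes-map-just (u ∘ suc) (upTo n)) ⟩
        inSubs (map (u ∘ suc) (upTo n)) w
          ≡⟨ any-map _ (u ∘ suc) (upTo n) ⟩
        any (λ i → inSub τ (u (suc i)) w) (upTo n)
          ≡⟨ any-map _ suc (upTo n) ⟨
        covered 0 w
          ∎
        where open ≡-Reasoning

    savedOutside : List V → ℕ
    savedOutside Vs = count τ (λ w → inSubs Vs w ∧ not (covered 0 w))

    -- The savings of Vs outside U are paid for by w̃t(u_1) + … + w̃t(u_t) = |covered 0| ∸ |covered t|.
    Charged : ℕ → List V → Set
    Charged t Vs = savedOutside Vs + count τ (covered t) ≤ count τ (covered 0)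

    module _ (lmax : ∀ v → lev v ≤ n) where

      newly-saved-bound : ∀ {t} v → t < lev v →
        count τ (λ w → inSub τ v w ∧ not (covered 0 w)) ≤ wt~ τ n u (suc t) (u (suc t))
      newly-saved-bound {t} v t<lev with a , a≼v , lev-a ← ancestor-at-level v t<lev = begin
        count τ (λ w → inSub τ v w ∧ not (covered 0 w))
          ≤⟨ countIn-mono vertices below-a ⟩
        count τ (λ w → inSub τ a w ∧ not (covered (suc t) w))
          ≤⟨ wt~-≥ (suc t) a ⟩
        wt~ τ n u (suc t) a
          ≤⟨ proj₂ (unb (suc t) (s≤s z≤n) (≤-trans t<lev (lmax v))) a lev-a ⟩
        wt~ τ n u (suc t) (u (suc t))
          ∎
        where
        open ≤-Reasoning
        below-a : ∀ w → T (inSub τ v w ∧ not (covered 0 w)) → T (inSub τ a w ∧ not (covered (suc t) w))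
        below-a w c with v≼w , fresh ← to T-∧ c =
          from T-∧ ( ≼⇒≼ᵇ (≼-trans a≼v (≼ᵇ⇒≼ {v} {w} v≼w))
                   , from T-not-≡ (¬T⇒≡false (subst T (to T-not-≡ fresh) ∘ covered-zero (suc t) w)))

      charged-vaccinate : ∀ t Vs v → stateAt t Vs v ≡ sus → Charged t Vs → Charged (suc t) (v ∷ Vs)
      charged-vaccinate t Vs v v-sus charged with not-burning⁻ t Vs v (proj₂ (status-sus⁻ _ _ v-sus))
      ... | inj₂ v-saved = begin
        savedOutside (v ∷ Vs) + C (suc t)  ≡⟨ cong (_+ C (suc t)) (countIn-cong vertices already-saved) ⟩
        savedOutside Vs + C (suc t)        ≤⟨ +-monoʳ-≤ (savedOutside Vs) (count-covered-suc t) ⟩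
        savedOutside Vs + C t              ≤⟨ charged ⟩
        C 0                                ∎
        where
        open ≤-Reasoning
        C : ℕ → ℕ
        C k = count τ (covered k)
        already-saved : ∀ w → (inSubs (v ∷ Vs) w ∧ not (covered 0 w)) ≡ (inSubs Vs w ∧ not (covered 0 w))
        already-saved w = cong (_∧ not (covered 0 w)) (T-ext
          ([ (λ v≼w → inSubs-≼ Vs (≼ᵇ⇒≼ {v} {w} v≼w) v-saved) , id ]′ ∘ to T-∨) (from T-∨ ∘ inj₂))
      ... | inj₁ t<lev = begin
        savedOutside (v ∷ Vs) + C (suc t)     ≤⟨ +-monoˡ-≤ (C (suc t)) split ⟩
        (new + savedOutside Vs) + C (suc t)   ≤⟨ +-monoˡ-≤ (C (suc t)) (+-monoˡ-≤ (savedOutside Vs) new≤gain) ⟩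
        (gain + savedOutside Vs) + C (suc t)  ≡⟨ cong (_+ C (suc t)) (+-comm gain (savedOutside Vs)) ⟩
        (savedOutside Vs + gain) + C (suc t)  ≡⟨ +-assoc (savedOutside Vs) gain (C (suc t)) ⟩
        savedOutside Vs + (gain + C (suc t))  ≡⟨ cong (savedOutside Vs +_) (count-covered-∷ t<n) ⟨
        savedOutside Vs + C t                 ≤⟨ charged ⟩
        C 0                                   ∎
        where
        open ≤-Reasoning
        C : ℕ → ℕ
        C k = count τ (covered k)
        new gain : ℕ
        new  = count τ (λ w → inSub τ v w ∧ not (covered 0 w))
        gain = wt~ τ n u (suc t) (u (suc t))
        new≤gain : new ≤ gain
        new≤gain = newly-saved-bound v t<lev
        t<n : t < n
        t<n = ≤-trans t<lev (lmax v)
        split : savedOutside (v ∷ Vs) ≤ new + savedOutside Vs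
        split = subst (_≤ new + savedOutside Vs)
          (countIn-cong vertices λ w → sym (∧-distribʳ-∨ (not (covered 0 w)) (inSub τ v w) (inSubs Vs w)))
          (countIn-∨ vertices (λ w → inSub τ v w ∧ not (covered 0 w)) (λ w → inSubs Vs w ∧ not (covered 0 w)))

      charged-run : ∀ cs t Vs {s} → s ≗ stateAt t Vs → Legal τ s cs →
                    Charged t Vs → savedOutside (catMaybes cs ʳ++ Vs) ≤ count τ (covered 0)
      charged-run []             t Vs s≗ _               charged = m+n≤o⇒m≤o _ charged
      charged-run (nothing ∷ cs) t Vs s≗ legal           charged =
        charged-run cs (suc t) Vs (step-nothing-stateAt t Vs s≗) legal
          (≤-trans (+-monoʳ-≤ (savedOutside Vs) (count-covered-suc t)) charged)
      charged-run (just v ∷ cs)  t Vs s≗ (v-sus , legal) charged =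
        charged-run cs (suc t) (v ∷ Vs) (step-just-stateAt t Vs s≗ v-sus) legal
          (charged-vaccinate t Vs v (trans (sym (s≗ v)) v-sus) charged)

      saved≤2*count-covered : ∀ cs → Legal τ (initial τ) cs → saved τ cs ≤ 2 * count τ (covered 0)
      saved≤2*count-covered cs legal = begin
        saved τ cs
          ≡⟨ saved-legal cs legal ⟩
        count τ H
          ≡⟨ countIn-split vertices H (covered 0) ⟩
        count τ (λ w → H w ∧ covered 0 w) + savedOutside Vc
          ≤⟨ +-mono-≤ (countIn-mono vertices {λ w → H w ∧ covered 0 w} {covered 0} (λ _ → proj₂ ∘ to T-∧))
                      (charged-run cs 0 [] initial-stateAt legal charged-initially) ⟩
        count τ (covered 0) + count τ (covered 0)
          ≡⟨ cong (count τ (covered 0) +_) (+-identityʳ _) ⟨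
        2 * count τ (covered 0)
          ∎
        where
        open ≤-Reasoning
        Vc : List V
        Vc = catMaybes cs ʳ++ []
        H : V → Bool
        H = inSubs Vc
        charged-initially : Charged 0 []
        charged-initially = ≤-reflexive (cong (_+ count τ (covered 0)) (countIn-false vertices λ _ → refl))

theorem1p1 : (T : RTree) → 1 ≤ RTree.m T →
    (n : ℕ) → ∃ (λ v → level T v ≡ n) → (∀ v → level T v ≤ n) →
    (u : ℕ → Vtx T) → Unburning T n u →
    (saved T (unburnStrategy T n u) ≡ wtSum T n u) ×
    (∀ (cs : List (Maybe (Vtx T))) → Legal T (initial T) cs →
      saved T cs ≤ 2 * saved T (unburnStrategy T n u))
theorem1p1 τ _ n _ lmax u unb =
    trans (saved-unburnStrategy unb) (sym (wtSum≡count-covered unb))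
  , λ cs legal → subst (λ k → saved τ cs ≤ 2 * k) (sym (saved-unburnStrategy unb))
                       (saved≤2*count-covered unb lmax cs legal)
  where open Unburning τ n u
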